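{- Let $n$ be a natural number ($n\ge 0$). The $\mathsf{T}^n_U$-algebra $(V^n,\sup^n)$ is initial: for every $\mathsf{T}^n_U$-algebra $(X,m)$, the type of $\mathsf{T}^n_U$-algebra homomorphisms from $(V^n,\sup^n)$ to $(X,m)$, namely $\sum_{\varphi:V^n\to X}\ \prod_{a:\mathsf{T}^n_U V^n}\varphi(\sup^n a)=m(\mathsf{T}^n_U\varphi\ a)$, is contractible.
   Context: Work in homotopy type theory with univalent universes $U:\mathsf{Type}$ (both closed under the usual type formers, $U$ containing $\emptyset$ and $\mathbb{N}$), function extensionality. A map $f:A\to X$ is $k$-truncated if all its homotopy fibers $\mathrm{fib}\,f\,x:=\sum_{a:A}f\,a=x$ are $k$-types; $A\hookrightarrow_k X$ denotes the type of $k$-truncated maps. For $n\ge 0$ (or $n=\infty$, where $\infty-1=\infty$ and every map is $\infty$-truncated), $\mathsf{T}^n_U X:=\sum_{A:U}(A\hookrightarrow_{n-1}X)$. A type is essentially $U$-small if it is equivalent to a type in $U$; $X$ is $0$-locally $U$-small if essentially $U$-small, $(k+1)$-locally $U$-small if all its identity types are $k$-locally $U$-small, and always $\infty$-locally $U$-small; "locally $U$-small" means $1$-locally $U$-small. Standing assumption (small images): for every $A:U$, every locally $U$-small $X$ and $f:A\to X$ there is $\mathrm{im}\,f:U$ with a surjection $A\twoheadrightarrow \mathrm{im}\,f$ and an embedding $\mathrm{incl}\,f:\mathrm{im}\,f\hookrightarrow X$ whose composite is definitionally $f$. Consequently, for $k\ge -2$, every $f:A\to X$ with $A:U$ and $X$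 $(k+2)$-locally $U$-small has a chosen $U$-small $k$-image $\mathrm{im}_k f:U$ with $k$-connected map $A\to\mathrm{im}_k f$ and $k$-truncated inclusion $\mathrm{incl}_k f:\mathrm{im}_k f\to X$ through which $f$ factors. For $Y$ $(n+1)$-locally $U$-small and $\varphi:X\to Y$, the functorial action is $\mathsf{T}^n_U\varphi(A,f):=(\mathrm{im}_{n-1}(\varphi\circ f),\mathrm{incl}_{n-1}(\varphi\circ f))$. A $\mathsf{T}^n_U$-algebra is a pair $(X,m)$ with $X$ an $(n+1)$-locally $U$-small type and $m:\mathsf{T}^n_U X\to X$. Let $V^\infty:=W_{A:U}A$ be the W-type with constructor $\sup^\infty:\sum_{A:U}(A\to V^\infty)\to V^\infty$. For $k\ge -1$ define by induction $\mathrm{isIt}_k(\sup^\infty(A,f)):=(f\text{ is }k\text{ -truncated})\times\prod_{a:A}\mathrm{isIt}_k(f\,a)$ (a proposition), and $V^{k+1}:=\sum_{x:V^\infty}\mathrm{isIt}_k\,x$. Define $\sup^n:\mathsf{T}^n_U V^n\to V^n$ by $\sup^n(A,f):=(\sup^\infty(A,\pi_0\circ f),-)$ (the proof component being determined). $V^n$ is locally $U$-small. -}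

{-# OPTIONS --without-K #-}
module Defs where

open import Level using (Level; _⊔_; Setω) renaming (suc to lsuc; zero to lzero)
open import Data.Nat using (ℕ; zero; suc)
open import Data.Product using (Σ; Σ-syntax; _×_; _,_; proj₁; proj₂)
open import Relation.Binary.PropositionalEquality
  using (_≡_; refl; sym; trans; cong; subst)

private
  variable
    ℓ ℓ' : Level

isContr : Set ℓ → Set ℓ
isContr A = Σ A λ c → (x : A) → c ≡ x

isProp : Set ℓ → Set ℓ
isProp A = (x y : A) → x ≡ y

data 𝕋 : Set where
  ⟨-2⟩ : 𝕋
  S    : 𝕋 → 𝕋

isType : 𝕋 → Set ℓ → Set ℓ
isType ⟨-2⟩  A = isContr A
isType (S k) A = (x y : A) → isType k (x ≡ y)

fib : {A : Set ℓ} {B : Set ℓ'} → (A → B) → B → Set (ℓ ⊔ ℓ')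
fib {A = A} f y = Σ A λ a → f a ≡ y

isTruncMap : 𝕋 → {A : Set ℓ} {B : Set ℓ'} → (A → B) → Set (ℓ ⊔ ℓ')
isTruncMap k f = ∀ y → isType k (fib f y)

isEquiv : {A : Set ℓ} {B : Set ℓ'} → (A → B) → Set (ℓ ⊔ ℓ')
isEquiv f = ∀ y → isContr (fib f y)

_≃_ : Set ℓ → Set ℓ' → Set (ℓ ⊔ ℓ')
A ≃ B = Σ (A → B) isEquiv

id-isEquiv : {A : Set ℓ} → isEquiv (λ (x : A) → x)
id-isEquiv y = (y , refl) , λ { (a , refl) → refl }

idtoeqv : {A B : Set ℓ} → A ≡ B → A ≃ B
idtoeqv refl = (λ x → x) , id-isEquiv

FunExt : Setω
FunExt = ∀ {ℓ ℓ'} {A : Set ℓ} {B : A → Set ℓ'} {f g : (x : A) → B x}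
         → ((x : A) → f x ≡ g x) → f ≡ g

Univalence : (ℓ : Level) → Set (lsuc ℓ)
Univalence ℓ = (A B : Set ℓ) → isEquiv (idtoeqv {A = A} {B = B})

-- The universes:  U = Set (= Set₀),  ambient  Type = Set₁

minus1 : ℕ → 𝕋
minus1 zero    = S ⟨-2⟩
minus1 (suc n) = S (minus1 n)

isEssSmall : Set₁ → Set₁
isEssSmall X = Σ Set λ B → B ≃ X

isLocSmall : ℕ → Set₁ → Set₁
isLocSmall zero    X = isEssSmall X
isLocSmall (suc m) X = (x y : X) → isLocSmall m (x ≡ y)

-- k-connected maps, via the (standard, HoTT book Lemma 7.5.7) universal property:
-- precomposition with c is an equivalence for every family of k-types.
isConnMap : 𝕋 → {A B : Set} → (A → B) → Set₂
isConnMap k {A} {B} c =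
  (P : B → Set₁) → ((b : B) → isType k (P b)) →
  isEquiv (λ (s : (b : B) → P b) (a : A) → s (c a))

record KImage (k : 𝕋) {A : Set} {X : Set₁} (f : A → X) : Set₂ where
  field
    im         : Set
    cover      : A → im
    incl       : im → X
    factor     : (a : A) → incl (cover a) ≡ f a
    cover-conn : isConnMap k cover
    incl-trunc : isTruncMap k incl

-- a choice of U-small k-images, for k = n - 1 ≥ -1, of maps A → X with
-- A : U and X (k+2) = (n+1)-locally U-small
ImageChoice : Set₂
ImageChoice = (n : ℕ) {A : Set} {X : Set₁} → isLocSmall (suc n) X →
              (f : A → X) → KImage (minus1 n) f

T : ℕ → Set₁ → Set₁
T n X = Σ Set λ A → Σ (A → X) λ f → isTruncMap (minus1 n) f

Tmap : ImageChoice → (n : ℕ) {X Y : Set₁} → isLocSmall (suc n) Y →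
       (X → Y) → T n X → T n Y
Tmap ic n lsY φ (A , f , _) =
  KImage.im K , KImage.incl K , KImage.incl-trunc K
  where K = ic n lsY (λ a → φ (f a))

data V∞ : Set₁ where
  sup∞ : (A : Set) → (A → V∞) → V∞

isIt : 𝕋 → V∞ → Set₁
isIt k (sup∞ A f) = isTruncMap k f × ((a : A) → isIt k (f a))

-- V^n := V^{(n-1)+1}
V : ℕ → Set₁
V n = Σ V∞ (isIt (minus1 n))

private
  trans-reflʳ : {A : Set ℓ} {x y : A} (p : x ≡ y) → trans p refl ≡ p
  trans-reflʳ refl = refl

  contr→prop : {A : Set ℓ} → isContr A → isProp A
  contr→prop (c , h) x y = trans (sym (h x)) (h y)

  prop-paths : {A : Set ℓ} → isProp A → {x y : A} (p q : x ≡ y) → p ≡ q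
  prop-paths {A = A} pr {x} {y} p q = trans (key p) (sym (key q))
    where
    g : (z : A) → x ≡ z
    g z = pr x z
    lem : {y z : A} (p : y ≡ z) → trans (g y) p ≡ g z
    lem refl = trans-reflʳ _
    canc : {y z : A} (a : x ≡ y) (b : x ≡ z) (p : y ≡ z) →
           trans a p ≡ b → p ≡ trans (sym a) b
    canc refl b p e = e
    key : (p : x ≡ y) → p ≡ trans (sym (g x)) (g y)
    key p = canc (g x) (g y) p (lem p)

  Σ-path : {A : Set ℓ} {P : A → Set ℓ'} {x x' : A} {y : P x} {y' : P x'}
           (p : x ≡ x') → subst P p y ≡ y' → _≡_ {A = Σ A P} (x , y) (x' , y')
  Σ-path refl refl = refl

  Σ-path-proj₁ : {A : Set ℓ} {P : A → Set ℓ'} {x x' : A} {y : P x} {y' : P x'}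
                 (p : x ≡ x') (h : subst P p y ≡ y') →
                 cong proj₁ (Σ-path {P = P} p h) ≡ p
  Σ-path-proj₁ refl refl = refl

  isProp-isContr : FunExt → {A : Set ℓ} → isProp (isContr A)
  isProp-isContr fe {A} (c , h) (c' , h') =
    Σ-path (h c') (fe λ x → prop-paths (contr→prop (c , h)) _ _)

  isProp-Π : FunExt → {A : Set ℓ} {B : A → Set ℓ'} →
             ((a : A) → isProp (B a)) → isProp ((a : A) → B a)
  isProp-Π fe pB f g = fe λ a → pB a (f a) (g a)

  isProp-× : {A : Set ℓ} {B : Set ℓ'} → isProp A → isProp B → isProp (A × B)
  isProp-× pA pB (a , b) (a' , b') with pA a a' | pB b b'
  ... | refl | refl = refl

  isProp-isType : FunExt → (k : 𝕋) {A : Set ℓ} → isProp (isType k A)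
  isProp-isType fe ⟨-2⟩  = isProp-isContr fe
  isProp-isType fe (S k) =
    isProp-Π fe λ x → isProp-Π fe λ y → isProp-isType fe k

  isProp-isIt : FunExt → (k : 𝕋) (w : V∞) → isProp (isIt k w)
  isProp-isIt fe k (sup∞ A f) =
    isProp-× (isProp-Π fe λ y → isProp-isType fe k)
             (isProp-Π fe λ a → isProp-isIt fe k (f a))

  retract : (k : 𝕋) {A : Set ℓ} {B : Set ℓ'} (r : B → A) (s : A → B) →
            ((a : A) → r (s a) ≡ a) → isType k B → isType k A
  retract ⟨-2⟩ r s rs (c , h) = r c , λ x → trans (cong r (h (s x))) (rs x)
  retract (S k) {A} r s rs tB x y =
    retract k r' (cong s) rs' (tB (s x) (s y))
    where
    r' : s x ≡ s y → x ≡ y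
    r' q = trans (sym (rs x)) (trans (cong r q) (rs y))
    aux : {a b : A} (e : a ≡ b) → trans (sym e) (trans refl e) ≡ refl
    aux refl = refl
    rs' : (p : x ≡ y) → r' (cong s p) ≡ p
    rs' refl = aux (rs x)

  go : FunExt → (k : 𝕋) {A : Set} (f : A → Σ V∞ (isIt (S k))) → isTruncMap (S k) f →
       (w : V∞) → isType (S k) (fib (λ a → proj₁ (f a)) w)
  go fe k {A} f tf' w (a , p) y =
    retract (S k) r s rs (tf' (w , q)) (a , p) y
    where
    P = isIt (S k)
    q : P w
    q = subst P p (proj₂ (f a))
    s : fib (λ a → proj₁ (f a)) w → fib f (w , q)
    s (a' , p') = a' , Σ-path {P = P} p' (isProp-isIt fe (S k) w _ _)
    r : fib f (w , q) → fib (λ a → proj₁ (f a)) w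
    r (a' , e) = a' , cong proj₁ e
    rs : (x : fib (λ a → proj₁ (f a)) w) → r (s x) ≡ x
    rs (a' , p') = cong (a' ,_) (Σ-path-proj₁ {P = P} p' _)

  proj₁-trunc : FunExt → (n : ℕ) {A : Set} (f : A → V n) →
                isTruncMap (minus1 n) f → isTruncMap (minus1 n) (λ a → proj₁ (f a))
  proj₁-trunc fe zero    f tf = go fe ⟨-2⟩ f tf
  proj₁-trunc fe (suc n) f tf = go fe (minus1 n) f tf

sup : FunExt → (n : ℕ) → T n (V n) → V n
sup fe n (A , f , tf) =
  sup∞ A (λ a → proj₁ (f a)) , proj₁-trunc fe n f tf , (λ a → proj₂ (f a))

AlgHom : FunExt → ImageChoice → (n : ℕ) (X : Set₁) → isLocSmall (suc n) X →
         (T n X → X) → Set₁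
AlgHom fe ic n X lsX m =
  Σ (V n → X) λ φ → (a : T n (V n)) → φ (sup fe n a) ≡ m (Tmap ic n lsX φ a)

UnivalenceU : Set₁
UnivalenceU = Univalence lzero

UnivalenceType : Set₂
UnivalenceType = Univalence (lsuc lzero)

{-# OPTIONS --without-K #-}
-- The map out of (Vⁿ, supⁿ) is defined by recursion on the underlying W-type;
-- it is a homomorphism definitionally, because Tⁿ φ only depends on φ ∘ f.
-- Any other homomorphism ψ agrees with it on every tree, by induction.  Since
-- truncatedness of maps and iterativity are propositions, the coherence of this
-- homotopy with the two homomorphism proofs comes down to the naturality of a
-- homotopy into a constant function, and homotopy induction (a form of function
-- extensionality) turns a coherent homotopy into an equality of homomorphisms.
module Submission where

open import Defs
open import Axiom.UniquenessOfIdentityProofs using (UIP; module Constant⇒UIP)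
open import Data.Nat using (ℕ; suc)
open import Data.Product using (Σ; _×_; _,_; proj₁; proj₂; uncurry)
open import Data.Product.Properties using (Σ-≡,≡→≡; ×-≡,≡→≡)
open import Function using (_∘_)
open import Level using (Level)
open import Relation.Binary.PropositionalEquality
  using (_≡_; _≗_; refl; sym; trans; cong; subst)
open import Relation.Binary.PropositionalEquality.Properties
  using (trans-reflʳ; trans-symˡ; cong-∘; module ≡-Reasoning)

private
  variable
    ℓ ℓ' ℓ'' : Level

trans-cancelʳ : {A : Set ℓ} {x y z : A} (p : x ≡ y) (q : z ≡ y) →
                trans (trans p (sym q)) q ≡ p
trans-cancelʳ p refl = trans (trans-reflʳ (trans p refl)) (trans-reflʳ p)

htpy-const-natural : {A : Set ℓ} {B : Set ℓ'} {F : A → B} {c : B}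
                     (h : (x : A) → F x ≡ c) {x y : A} (d : x ≡ y) →
                     trans (cong F d) (h y) ≡ h x
htpy-const-natural h refl = refl

isContr→isProp : {A : Set ℓ} → isContr A → isProp A
isContr→isProp (_ , h) x y = trans (sym (h x)) (h y)

isProp→UIP : {A : Set ℓ} → isProp A → UIP A
isProp→UIP pr = Constant⇒UIP.≡-irrelevant (λ {x} {y} _ → pr x y) (λ _ _ → refl)

isProp-isContr : FunExt → {A : Set ℓ} → isProp (isContr A)
isProp-isContr fe c@(_ , h) (y , h') =
  Σ-≡,≡→≡ (h y , fe λ z → isProp→UIP (isContr→isProp c) _ _)

isProp-Π : FunExt → {A : Set ℓ} {B : A → Set ℓ'} →
           ((a : A) → isProp (B a)) → isProp ((a : A) → B a)
isProp-Π fe pB f g = fe λ a → pB a (f a) (g a)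

isProp-× : {A : Set ℓ} {B : Set ℓ'} → isProp A → isProp B → isProp (A × B)
isProp-× pA pB (a , b) (a' , b') = ×-≡,≡→≡ (pA a a' , pB b b')

isProp-isType : FunExt → (k : 𝕋) {A : Set ℓ} → isProp (isType k A)
isProp-isType fe ⟨-2⟩  = isProp-isContr fe
isProp-isType fe (S k) =
  isProp-Π fe λ _ → isProp-Π fe λ _ → isProp-isType fe k

isProp-isTruncMap : FunExt → (k : 𝕋) {A : Set ℓ} {B : Set ℓ'} (f : A → B) →
                    isProp (isTruncMap k f)
isProp-isTruncMap fe k f = isProp-Π fe λ _ → isProp-isType fe k

isProp-isIt : FunExt → (k : 𝕋) (w : V∞) → isProp (isIt k w)
isProp-isIt fe k (sup∞ A f) =
  isProp-× (isProp-isTruncMap fe k f) (isProp-Π fe λ a → isProp-isIt fe k (f a))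

isType-retract : (k : 𝕋) {A : Set ℓ} {B : Set ℓ'} (r : B → A) (s : A → B) →
                 ((a : A) → r (s a) ≡ a) → isType k B → isType k A
isType-retract ⟨-2⟩  r s rs (c , h) = r c , λ x → trans (cong r (h (s x))) (rs x)
isType-retract (S k) r s rs tB x y =
  isType-retract k r' (cong s) r's (tB (s x) (s y))
  where
  r' : s x ≡ s y → x ≡ y
  r' q = trans (sym (rs x)) (trans (cong r q) (rs y))
  r's : (p : x ≡ y) → r' (cong s p) ≡ p
  r's refl = trans-symˡ (rs x)

Σ-≡,≡→≡-cong-proj₁ : {A : Set ℓ} {P : A → Set ℓ'} → ((a : A) → isProp (P a)) →
                     {x y : Σ A P} (e : x ≡ y)
                     (r : subst P (cong proj₁ e) (proj₂ x) ≡ proj₂ y) →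
                     Σ-≡,≡→≡ (cong proj₁ e , r) ≡ e
Σ-≡,≡→≡-cong-proj₁ pP {x} refl r =
  cong (λ r' → Σ-≡,≡→≡ (refl , r')) (isProp→UIP (pP (proj₁ x)) r refl)

isTruncMap-pair : (k : 𝕋) {A : Set ℓ} {B : Set ℓ'} {P : B → Set ℓ''} →
                  ((b : B) → isProp (P b)) →
                  (f : A → B) (ps : (a : A) → P (f a)) → isTruncMap k f →
                  isTruncMap k (λ a → f a , ps a)
isTruncMap-pair k {P = P} pP f ps tf (w , q) = isType-retract k r s rs (tf w)
  where
  s : fib (λ a → f a , ps a) (w , q) → fib f w
  s (a , e) = a , cong proj₁ e
  r : fib f w → fib (λ a → f a , ps a) (w , q)
  r (a , p) = a , Σ-≡,≡→≡ (p , pP w _ q)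
  rs : (x : fib (λ a → f a , ps a) (w , q)) → r (s x) ≡ x
  rs (a , e) = cong (a ,_) (Σ-≡,≡→≡-cong-proj₁ pP e _)

module HomotopyInduction (fe : FunExt) {ℓ ℓ'} {A : Set ℓ} {B : Set ℓ'} {f : A → B} where

  htpy-singleton-isContr : isContr (Σ (A → B) (f ≗_))
  htpy-singleton-isContr =
    (f , λ _ → refl) , λ { (g , H) → cong unzip (fe λ x → singleton (H x)) }
    where
    singleton : {x : A} {y : B} (p : f x ≡ y) →
                _≡_ {A = Σ B (f x ≡_)} (f x , refl) (y , p)
    singleton refl = refl
    unzip : ((x : A) → Σ B (f x ≡_)) → Σ (A → B) (f ≗_)
    unzip s = (λ x → proj₁ (s x)) , (λ x → proj₂ (s x))

  htpy-ind : (Q : (g : A → B) → f ≗ g → Set ℓ'') → Q f (λ _ → refl) →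
             (g : A → B) (H : f ≗ g) → Q g H
  htpy-ind Q q g H =
    subst (uncurry Q) (isContr→isProp htpy-singleton-isContr _ (g , H)) q

  htpy-ind-refl : (Q : (g : A → B) → f ≗ g → Set ℓ'') (q : Q f (λ _ → refl)) →
                  htpy-ind Q q f (λ _ → refl) ≡ q
  htpy-ind-refl Q q =
    cong (λ e → subst (uncurry Q) e q)
         (trans-symˡ (proj₂ htpy-singleton-isContr (f , λ _ → refl)))

  funext : {g : A → B} → f ≗ g → f ≡ g
  funext {g} = htpy-ind (λ g _ → f ≡ g) refl g

  funext-refl : funext (λ _ → refl) ≡ refl
  funext-refl = htpy-ind-refl (λ g _ → f ≡ g) refl

module Initiality (fe : FunExt) (ic : ImageChoice) (n : ℕ) (X : Set₁)
                  (lsX : isLocSmall (suc n) X) (m : T n X → X) where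
  open HomotopyInduction fe

  k : 𝕋
  k = minus1 n

  image : {A : Set} → (A → X) → T n X
  image G = KImage.im K , KImage.incl K , KImage.incl-trunc K
    where K = ic n lsX G

  IsHom : (V n → X) → Set₁
  IsHom ψ = (a : T n (V n)) → ψ (sup fe n a) ≡ m (Tmap ic n lsX ψ a)

  sup-trunc : ((A , g , _) : T n (V n)) → isTruncMap k (proj₁ ∘ g)
  sup-trunc a = proj₁ (proj₂ (sup fe n a))

  rec : (w : V∞) → isIt k w → X
  rec (sup∞ A f) (_ , ps) = m (image (λ a → rec (f a) (ps a)))

  φ : V n → X
  φ (w , p) = rec w p

  φ-isHom : IsHom φ
  φ-isHom _ = refl

  cong-image : {ψ ψ' : V n → X} → ψ ≗ ψ' → (a : T n (V n)) →
               m (Tmap ic n lsX ψ a) ≡ m (Tmap ic n lsX ψ' a)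
  cong-image H (_ , g , _) = cong (m ∘ image) (funext (H ∘ g))

  cong-image-refl : {ψ : V n → X} (a : T n (V n)) →
                    cong-image (λ v → refl {x = ψ v}) a ≡ refl
  cong-image-refl {ψ} a = cong (cong (m ∘ image)) (funext-refl {f = ψ ∘ proj₁ (proj₂ a)})

  IsHomHtpy : {ψ : V n → X} → φ ≗ ψ → IsHom ψ → Set₁
  IsHomHtpy H h = (a : T n (V n)) → trans (H (sup fe n a)) (h a) ≡ cong-image H a

  AlgHom-≡ : (ψ : V n → X) (H : φ ≗ ψ) (h : IsHom ψ) → IsHomHtpy H h →
             _≡_ {A = AlgHom fe ic n X lsX m} (φ , φ-isHom) (ψ , h)
  AlgHom-≡ = htpy-ind (λ ψ H → (h : IsHom ψ) → IsHomHtpy H h → (φ , φ-isHom) ≡ (ψ , h))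
    λ h coh → cong (φ ,_) (fe λ a → sym (trans (coh a) (cong-image-refl {φ} a)))

  module _ (ψ : V n → X) (h : IsHom ψ) where

    ψ-sup∞ : {A : Set} (f : A → V∞) (t : isTruncMap k f) (ps : (a : A) → isIt k (f a)) →
             ψ (sup∞ A f , t , ps) ≡ m (image (λ a → ψ (f a , ps a)))
    ψ-sup∞ {A} f t ps =
      trans (cong (λ t' → ψ (sup∞ A f , t' , ps)) (isProp-isTruncMap fe k f _ _))
            (h (A , _ , isTruncMap-pair k (isProp-isIt fe k) f ps t))

    ψ-sup∞-sup : ((A , g , tg) : T n (V n)) →
                 ψ-sup∞ (proj₁ ∘ g) (sup-trunc (A , g , tg)) (proj₂ ∘ g) ≡ h (A , g , tg)
    ψ-sup∞-sup (A , g , tg) = begin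
      trans (cong ψ∘G q) (h a₁)             ≡⟨ cong (λ r → trans (cong ψ∘G r) (h a₁))
                                                  (isProp→UIP (isProp-isTruncMap fe k f) q (cong PT d)) ⟩
      trans (cong ψ∘G (cong PT d)) (h a₁)   ≡⟨ cong (λ r → trans r (h a₁)) (sym (cong-∘ d)) ⟩
      trans (cong (ψ∘G ∘ PT) d) (h a₁)      ≡⟨ htpy-const-natural (λ t → h (A , g , t)) d ⟩
      h (A , g , tg)                        ∎
      where
      open ≡-Reasoning
      f : A → V∞
      f = proj₁ ∘ g
      ψ∘G : isTruncMap k f → X
      ψ∘G t = ψ (sup∞ A f , t , proj₂ ∘ g)
      PT : isTruncMap k g → isTruncMap k f
      PT t = sup-trunc (A , g , t)
      t₁ : isTruncMap k g
      t₁ = isTruncMap-pair k (isProp-isIt fe k) f (proj₂ ∘ g) (PT tg)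
      a₁ : T n (V n)
      a₁ = A , g , t₁
      q : PT tg ≡ PT t₁
      q = isProp-isTruncMap fe k f (PT tg) (PT t₁)
      d : tg ≡ t₁
      d = isProp-isTruncMap fe k g tg t₁

    rec≗ψ : (w : V∞) (p : isIt k w) → rec w p ≡ ψ (w , p)
    rec≗ψ (sup∞ A f) (t , ps) =
      trans (cong (m ∘ image) (funext λ a → rec≗ψ (f a) (ps a))) (sym (ψ-sup∞ f t ps))

    φ≗ψ : φ ≗ ψ
    φ≗ψ (w , p) = rec≗ψ w p

    φ≗ψ-isHomHtpy : IsHomHtpy φ≗ψ h
    φ≗ψ-isHomHtpy a =
      trans (cong (λ r → trans (trans (cong-image φ≗ψ a) (sym r)) (h a)) (ψ-sup∞-sup a))
            (trans-cancelʳ (cong-image φ≗ψ a) (h a))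

  AlgHom-isContr : isContr (AlgHom fe ic n X lsX m)
  AlgHom-isContr =
    (φ , φ-isHom) , λ { (ψ , h) → AlgHom-≡ ψ (φ≗ψ ψ h) h (φ≗ψ-isHomHtpy ψ h) }

mainTheorem1 : (fe : FunExt) → UnivalenceU → UnivalenceType →
    (ic : ImageChoice) → (n : ℕ) →
    (X : Set₁) → (lsX : isLocSmall (suc n) X) → (m : T n X → X) →
    isContr (AlgHom fe ic n X lsX m)
mainTheorem1 fe _ _ ic n X lsX m = Initiality.AlgHom-isContr fe ic n X lsX m
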